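{- Let $n \geq 2$. Approval ballot triangles of size $n-1$ are in bijection with TSSCPP Boolean triangles of order $n$.
   Context: An approval ballot triangle (ABT) of size $m$ is a triangular array $A(i,j)$, $1 \leq j \leq i \leq m$, with entries in $\{0,1\}$ such that $\sum_{k=j}^{i} A(i,k) \leq \sum_{k=j}^{i+1} A(i+1,k)$ for all $1 \leq j \leq i \leq m-1$. A TSSCPP Boolean triangle of order $n$ is an array $B(r,s)$ with entries in $\{0,1\}$, indexed by $1 \leq r \leq n-1$ and $n-r \leq s \leq n-1$, satisfying the column compatibility condition $1 + \sum_{r=t+1}^{s} B(r,n-t-1) \geq \sum_{r=t}^{s} B(r,n-t)$ for all integers $t,s$ with $1 \leq t$ and $t+1 \leq s \leq n-1$. -}

module Defs where

open import Data.Nat using (ℕ; zero; suc; _+_; _∸_; _≤_)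
open import Data.Bool using (Bool; true; false)
open import Data.Product using (Σ; proj₁)
open import Relation.Binary.PropositionalEquality using (_≡_; refl; sym; trans)
open import Relation.Binary.Bundles using (Setoid)
open import Relation.Binary.Structures using (IsEquivalence)
open import Level using (0ℓ)

b2n : Bool → ℕ
b2n false = 0
b2n true  = 1

-- sumFromTo a b f = Σ_{k=a}^{b} f k   (empty, i.e. 0, when b < a)
sumLen : ℕ → ℕ → (ℕ → ℕ) → ℕ
sumLen a zero    f = 0
sumLen a (suc l) f = f a + sumLen (suc a) l f

sumFromTo : ℕ → ℕ → (ℕ → ℕ) → ℕ
sumFromTo a b f = sumLen a (suc b ∸ a) f

-- A triangular 0/1 array is represented by a function ℕ → ℕ → Bool;
-- only the entries inside the index domain matter (see the setoids below).

IsABT : ℕ → (ℕ → ℕ → Bool) → Set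
IsABT m A = ∀ i j → 1 ≤ j → j ≤ i → i ≤ m ∸ 1 →
  sumFromTo j i (λ k → b2n (A i k)) ≤ sumFromTo j (suc i) (λ k → b2n (A (suc i) k))

InABT : ℕ → ℕ → ℕ → Set
InABT m i j = 1 ≤ j × j ≤ i × i ≤ m
  where open import Data.Product using (_×_)

IsTSSCPPBool : ℕ → (ℕ → ℕ → Bool) → Set
IsTSSCPPBool n B = ∀ t s → 1 ≤ t → suc t ≤ s → s ≤ n ∸ 1 →
  sumFromTo t s (λ r → b2n (B r (n ∸ t))) ≤
  1 + sumFromTo (suc t) s (λ r → b2n (B r (n ∸ t ∸ 1)))

InTSSCPP : ℕ → ℕ → ℕ → Set
InTSSCPP n r s = 1 ≤ r × r ≤ n ∸ 1 × n ∸ r ≤ s × s ≤ n ∸ 1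
  where open import Data.Product using (_×_)

ABT-Setoid : ℕ → Setoid 0ℓ 0ℓ
ABT-Setoid m = record
  { Carrier = Σ (ℕ → ℕ → Bool) (IsABT m)
  ; _≈_ = λ A A′ → ∀ i j → InABT m i j → proj₁ A i j ≡ proj₁ A′ i j
  ; isEquivalence = record
    { refl = λ i j _ → refl
    ; sym = λ p i j d → sym (p i j d)
    ; trans = λ p q i j d → trans (p i j d) (q i j d)
    }
  }

TSSCPPBool-Setoid : ℕ → Setoid 0ℓ 0ℓ
TSSCPPBool-Setoid n = record
  { Carrier = Σ (ℕ → ℕ → Bool) (IsTSSCPPBool n)
  ; _≈_ = λ B B′ → ∀ r s → InTSSCPP n r s → proj₁ B r s ≡ proj₁ B′ r s
  ; isEquivalence = record
    { refl = λ r s _ → refl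
    ; sym = λ p r s d → sym (p r s d)
    ; trans = λ p q r s d → trans (p r s d) (q r s d)
    }
  }

-- Complementing every entry and reading each row of an approval ballot triangle backwards as a
-- column, B(r, s) = 1 − A(s, n − r), turns a partial row sum Σ_{k=j}^{i} A(i,k) into
-- (i − j + 1) − Σ_{r=n−i}^{n−j} B(r, i).  Under this substitution the ABT inequality at (i, j)
-- becomes exactly the TSSCPP column inequality at (t, s) = (n − 1 − i, n − j), and
-- (i, j) ↦ (n − 1 − i, n − j) is a bijection between the two families of constraints.
module Submission where

open import Defs
open import Data.Nat using (ℕ; _≤_; _∸_)
open import Function.Bundles using (Bijection)

open import Data.Bool using (Bool; true; false; not)
open import Data.Bool.Properties using (not-involutive; not-injective)
open import Data.Nat using (zero; suc; _+_; _<_; z≤n; s≤s)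
open import Data.Nat.Properties
open import Data.Nat.Tactic.RingSolver using (solve-∀)
open import Data.Product using (Σ; _,_)
open import Function using (_∘_)
open import Function.Bundles using (_⇔_; mk⇔; Equivalence)
open import Relation.Binary.Bundles using (Setoid)
open import Relation.Binary.PropositionalEquality
  using (_≡_; refl; sym; trans; cong; cong₂; subst; subst₂; module ≡-Reasoning)

sumLen-snoc : ∀ a l (f : ℕ → ℕ) → sumLen a (suc l) f ≡ sumLen a l f + f (a + l)
sumLen-snoc a zero f = trans (+-identityʳ (f a)) (cong f (sym (+-identityʳ a)))
sumLen-snoc a (suc l) f = begin
  f a + sumLen (suc a) (suc l) f                 ≡⟨ cong (f a +_) (sumLen-snoc (suc a) l f) ⟩
  f a + (sumLen (suc a) l f + f (suc a + l))     ≡⟨ sym (+-assoc (f a) _ _) ⟩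
  f a + sumLen (suc a) l f + f (suc (a + l))     ≡⟨ cong (λ m → f a + sumLen (suc a) l f + f m) (sym (+-suc a l)) ⟩
  f a + sumLen (suc a) l f + f (a + suc l)       ∎
  where open ≡-Reasoning

sumFromTo-+ : ∀ a l {b} (f : ℕ → ℕ) → a + l ≡ b → sumFromTo a b f ≡ sumLen a (suc l) f
sumFromTo-+ a l f refl =
  cong (λ m → sumLen a m f) (trans (cong (_∸ a) (sym (+-suc a l))) (m+n∸m≡n a (suc l)))

b2n+b2n∘not : ∀ x → b2n x + b2n (not x) ≡ 1
b2n+b2n∘not false = refl
b2n+b2n∘not true  = refl

MirrorComplement : ℕ → (ℕ → Bool) → (ℕ → Bool) → Set
MirrorComplement c f g = ∀ k → k ≤ c → g k ≡ not (f (c ∸ k))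

-- a + l + b = c + 1 says that k ↦ c ∸ k maps the window [b, b + l) onto [a, a + l).
sumLen-mirrorComplement : ∀ {c} f g a b l → MirrorComplement c f g → a + l + b ≡ suc c →
  sumLen a l (b2n ∘ f) + sumLen b l (b2n ∘ g) ≡ l
sumLen-mirrorComplement f g a b zero mirror eq = refl
sumLen-mirrorComplement {c} f g a b (suc l) mirror eq = begin
  (F a + sumLen (suc a) l F) + sumLen b (suc l) G
    ≡⟨ cong ((F a + sumLen (suc a) l F) +_) (sumLen-snoc b l G) ⟩
  (F a + sumLen (suc a) l F) + (sumLen b l G + G (b + l))
    ≡⟨ regroup (F a) (sumLen (suc a) l F) (sumLen b l G) (G (b + l)) ⟩
  (sumLen (suc a) l F + sumLen b l G) + (F a + G (b + l))
    ≡⟨ cong₂ _+_ (sumLen-mirrorComplement f g (suc a) b l mirror eq′) paired ⟩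
  l + 1
    ≡⟨ +-comm l 1 ⟩
  suc l ∎
  where
  open ≡-Reasoning
  F G : ℕ → ℕ
  F = b2n ∘ f
  G = b2n ∘ g
  regroup : ∀ x p q y → (x + p) + (q + y) ≡ (p + q) + (x + y)
  regroup = solve-∀
  eq′ : suc a + l + b ≡ suc c
  eq′ = trans (cong (_+ b) (sym (+-suc a l))) eq
  c≡ : a + (b + l) ≡ c
  c≡ = suc-injective (trans (reassoc a b l) eq)
    where
    reassoc : ∀ a b l → suc (a + (b + l)) ≡ a + suc l + b
    reassoc = solve-∀
  paired : F a + G (b + l) ≡ 1
  paired = begin
    F a + G (b + l)                     ≡⟨ cong (λ x → F a + b2n x) (mirror (b + l) b+l≤c) ⟩
    F a + b2n (not (f (c ∸ (b + l))))   ≡⟨ cong (λ k → F a + b2n (not (f k))) c∸[b+l]≡a ⟩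
    b2n (f a) + b2n (not (f a))         ≡⟨ b2n+b2n∘not (f a) ⟩
    1                                   ∎
    where
    b+l≤c : b + l ≤ c
    b+l≤c = subst (b + l ≤_) c≡ (m≤n+m (b + l) a)
    c∸[b+l]≡a : c ∸ (b + l) ≡ a
    c∸[b+l]≡a = trans (cong (_∸ (b + l)) (sym c≡)) (m+n∸n≡m a (b + l))

≤⇔complement-≤ : ∀ {L P Q X Y} → P + Y ≡ suc L → Q + X ≡ suc (suc L) → P ≤ Q ⇔ X ≤ suc Y
≤⇔complement-≤ {L} {P} {Q} {X} {Y} P+Y≡ Q+X≡ = mk⇔
  (λ P≤Q → +-cancelˡ-≤ Q X (suc Y) (begin
    Q + X        ≡⟨ trans Q+X≡ (cong suc (sym P+Y≡)) ⟩
    suc (P + Y)  ≡⟨ sym (+-suc P Y) ⟩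
    P + suc Y    ≤⟨ +-monoˡ-≤ (suc Y) P≤Q ⟩
    Q + suc Y    ∎))
  (λ X≤1+Y → +-cancelʳ-≤ (suc Y) P Q (begin
    P + suc Y    ≡⟨ trans (+-suc P Y) (cong suc P+Y≡) ⟩
    suc (suc L)  ≡⟨ sym Q+X≡ ⟩
    Q + X        ≤⟨ +-monoʳ-≤ Q X≤1+Y ⟩
    Q + suc Y    ∎))
  where open ≤-Reasoning

Dual : ℕ → (ℕ → ℕ → Bool) → (ℕ → ℕ → Bool) → Set
Dual n A B = ∀ i → MirrorComplement n (A i) (λ r → B r i)

abt-constraint⇔tsscpp-constraint : ∀ {n i s} A B j L t → Dual n A B →
  j + L ≡ i → suc t + L ≡ s → suc i + t ≡ n →
  sumFromTo j i (λ k → b2n (A i k)) ≤ sumFromTo j (suc i) (λ k → b2n (A (suc i) k))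
  ⇔ sumFromTo t s (λ r → b2n (B r (n ∸ t))) ≤ 1 + sumFromTo (suc t) s (λ r → b2n (B r (n ∸ t ∸ 1)))
abt-constraint⇔tsscpp-constraint {i = i} A B j L t dual refl refl refl
  rewrite m+n∸n≡m (suc i) t =
  subst₂ _⇔_
    (cong₂ _≤_ (sym (sumFromTo-+ j L (b2n ∘ A i) refl))
               (sym (sumFromTo-+ j (suc L) (b2n ∘ A (suc i)) (+-suc j L))))
    (cong₂ _≤_ (sym (sumFromTo-+ t (suc L) (λ r → b2n (B r (suc i))) (+-suc t L)))
               (cong suc (sym (sumFromTo-+ (suc t) L (λ r → b2n (B r i)) refl))))
    (≤⇔complement-≤
      (sumLen-mirrorComplement (A i) (λ r → B r i) j (suc t) (suc L) (dual i) (row-window j L t))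
      (sumLen-mirrorComplement (A (suc i)) (λ r → B r (suc i)) j t (suc (suc L)) (dual (suc i))
                               (next-row-window j L t)))
  where
  row-window : ∀ j L t → j + suc L + suc t ≡ suc (suc (j + L) + t)
  row-window = solve-∀
  next-row-window : ∀ j L t → j + suc (suc L) + t ≡ suc (suc (j + L) + t)
  next-row-window = solve-∀

≤∸1⇒< : ∀ {m n} → 1 ≤ m → m ≤ n ∸ 1 → m < n
≤∸1⇒< {n = zero} (s≤s _) ()
≤∸1⇒< {n = suc n} _     m≤n = s≤s m≤n

+≡⇒≤∸1 : ∀ {m k n} → 1 ≤ k → m + k ≡ n → m ≤ n ∸ 1
+≡⇒≤∸1 {m} {suc k} _ refl rewrite +-suc m k = m≤m+n m k

dual-isABT⇒isTSSCPPBool : ∀ {n A B} → Dual n A B → IsABT (n ∸ 1) A → IsTSSCPPBool n B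
dual-isABT⇒isTSSCPPBool {n} {A} {B} dual abt t s 1≤t t<s s≤n∸1
  with L , refl ← m≤n⇒∃[o]m+o≡n t<s
  with o , 1+s+o≡n ← m≤n⇒∃[o]m+o≡n (≤∸1⇒< (≤-trans (s≤s z≤n) t<s) s≤n∸1)
  = Equivalence.to (abt-constraint⇔tsscpp-constraint A B (suc o) L t dual refl refl 1+i+t≡n)
      (abt (suc o + L) (suc o) (s≤s z≤n) (m≤m+n (suc o) L) (∸-monoˡ-≤ 1 (+≡⇒≤∸1 1≤t 1+i+t≡n)))
  where
  1+i+t≡n : suc (suc o + L) + t ≡ n
  1+i+t≡n = trans (reorder o L t) 1+s+o≡n
    where
    reorder : ∀ o L t → suc (suc o + L) + t ≡ suc (suc t + L) + o
    reorder = solve-∀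

dual-isTSSCPPBool⇒isABT : ∀ {n A B} → Dual n A B → IsTSSCPPBool n B → IsABT (n ∸ 1) A
dual-isTSSCPPBool⇒isABT {n} {A} {B} dual tss i j 1≤j j≤i i≤n∸2
  with L , refl ← m≤n⇒∃[o]m+o≡n j≤i
  with t , 2+i+t≡n ← m≤n⇒∃[o]m+o≡n (≤∸1⇒< (s≤s z≤n) (≤∸1⇒< (≤-trans 1≤j j≤i) i≤n∸2))
  = Equivalence.from (abt-constraint⇔tsscpp-constraint A B j L (suc t) dual refl refl 1+i+1+t≡n)
      (tss (suc t) (suc (suc t) + L) (s≤s z≤n) (m≤m+n (suc (suc t)) L) (+≡⇒≤∸1 1≤j s+j≡n))
  where
  1+i+1+t≡n : suc i + suc t ≡ n
  1+i+1+t≡n = trans (+-suc (suc i) t) 2+i+t≡n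
  s+j≡n : suc (suc t) + L + j ≡ n
  s+j≡n = trans (reorder j L t) 2+i+t≡n
    where
    reorder : ∀ j L t → suc (suc t) + L + j ≡ suc (suc (j + L)) + t
    reorder = solve-∀

abt⇒tsscpp : ℕ → (ℕ → ℕ → Bool) → (ℕ → ℕ → Bool)
abt⇒tsscpp n A r s = not (A s (n ∸ r))

tsscpp⇒abt : ℕ → (ℕ → ℕ → Bool) → (ℕ → ℕ → Bool)
tsscpp⇒abt n B i k = not (B (n ∸ k) i)

dual-abt⇒tsscpp : ∀ n A → Dual n A (abt⇒tsscpp n A)
dual-abt⇒tsscpp n A i r _ = refl

dual-tsscpp⇒abt : ∀ n B → Dual n (tsscpp⇒abt n B) B
dual-tsscpp⇒abt n B i r r≤n =
  sym (trans (not-involutive _) (cong (λ r′ → B r′ i) (m∸[m∸n]≡n r≤n)))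

inABT⇒inTSSCPP : ∀ {n i j} → InABT (n ∸ 1) i j → InTSSCPP n (n ∸ j) i
inABT⇒inTSSCPP {n} {j = j} (1≤j , j≤i , i≤n∸1) =
  m<n⇒0<n∸m j<n , ∸-monoʳ-≤ n 1≤j , subst (_≤ _) (sym (m∸[m∸n]≡n (<⇒≤ j<n))) j≤i , i≤n∸1
  where
  j<n : j < n
  j<n = ≤∸1⇒< 1≤j (≤-trans j≤i i≤n∸1)

inTSSCPP⇒inABT : ∀ {n r s} → InTSSCPP n r s → InABT (n ∸ 1) s (n ∸ r)
inTSSCPP⇒inABT (1≤r , r≤n∸1 , n∸r≤s , s≤n∸1) = m<n⇒0<n∸m (≤∸1⇒< 1≤r r≤n∸1) , n∸r≤s , s≤n∸1

abt↔tsscpp : ∀ n → Bijection (ABT-Setoid (n ∸ 1)) (TSSCPPBool-Setoid n)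
abt↔tsscpp n = record
  { to        = to
  ; cong      = λ {A} {A′} → to-cong {A} {A′}
  ; bijective = (λ {A} {A′} → injective {A} {A′}) , surjective
  }
  where
  open Setoid (ABT-Setoid (n ∸ 1)) using () renaming (Carrier to ABT; _≈_ to _≈ᴬ_)
  open Setoid (TSSCPPBool-Setoid n) using () renaming (Carrier to TSSCPPBool; _≈_ to _≈ᴮ_)

  to : ABT → TSSCPPBool
  to (A , abt) = abt⇒tsscpp n A , dual-isABT⇒isTSSCPPBool (dual-abt⇒tsscpp n A) abt

  to-cong : ∀ {A A′} → A ≈ᴬ A′ → to A ≈ᴮ to A′
  to-cong A≈A′ r s d = cong not (A≈A′ s (n ∸ r) (inTSSCPP⇒inABT d))

  injective : ∀ {A A′} → to A ≈ᴮ to A′ → A ≈ᴬ A′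
  injective {A , _} {A′ , _} toA≈toA′ i j d@(_ , j≤i , i≤n∸1) = begin
    A i j                ≡⟨ cong (A i) (sym n∸[n∸j]≡j) ⟩
    A i (n ∸ (n ∸ j))    ≡⟨ not-injective (toA≈toA′ (n ∸ j) i (inABT⇒inTSSCPP d)) ⟩
    A′ i (n ∸ (n ∸ j))   ≡⟨ cong (A′ i) n∸[n∸j]≡j ⟩
    A′ i j               ∎
    where
    open ≡-Reasoning
    n∸[n∸j]≡j : n ∸ (n ∸ j) ≡ j
    n∸[n∸j]≡j = m∸[m∸n]≡n (≤-trans j≤i (≤-trans i≤n∸1 (m∸n≤m n 1)))

  surjective : ∀ B → Σ ABT λ A → ∀ {A′} → A′ ≈ᴬ A → to A′ ≈ᴮ B
  surjective (B , tss) = A , λ {A′} → to-A′≈B {A′}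
    where
    A : ABT
    A = tsscpp⇒abt n B , dual-isTSSCPPBool⇒isABT (dual-tsscpp⇒abt n B) tss
    to-A′≈B : ∀ {A′} → A′ ≈ᴬ A → to A′ ≈ᴮ (B , tss)
    to-A′≈B A′≈A r s d@(_ , r≤n∸1 , _) =
      trans (cong not (A′≈A s (n ∸ r) (inTSSCPP⇒inABT d)))
            (sym (dual-tsscpp⇒abt n B s r (≤-trans r≤n∸1 (m∸n≤m n 1))))

proposition3p4 : (n : ℕ) → 2 ≤ n → Bijection (ABT-Setoid (n ∸ 1)) (TSSCPPBool-Setoid n)
proposition3p4 n _ = abt↔tsscpp n
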